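{- Let $G$ be a graph with rooted branch decomposition $(T,\delta)$, and let $t$ be a node of $T$ with exactly two children $r$ and $s$. Let $\tau\in\mathcal{T}_t$ and let $(\mathcal{C},B)$ be a partial $b$-coloring of $G_t$ with a colour class $C$ that is valid and has $t$-type $\tau$ (w.r.t. $B$). Then there is a pair of compatible types $\rho\in\mathcal{T}_r$, $\sigma\in\mathcal{T}_s$ such that $C\cap V_r$ is valid and of $r$-type $\rho$ w.r.t. $B\cap V_r$, and $C\cap V_s$ is valid and of $s$-type $\sigma$ w.r.t. $B\cap V_s$.
   Context: Graphs are finite and simple. A rooted branch decomposition of $G$ is a pair $(T,\delta)$ with $T$ a rooted tree of maximum degree at most $3$ and $\delta$ a bijection from $V(G)$ to the leaves of $T$. For a node $t$: $V_t$ is the set of vertices mapped to leaves of the subtree rooted at $t$, $\overline{V_t}=V(G)\setminus V_t$, $G_t=G[V_t]$, and $\sim_t$ is the equivalence relation on $V_t$ with $u\sim_t v$ iff $N_G(u)\cap\overline{V_t}=N_G(v)\cap\overline{V_t}$. Operator: if $t$ has children $r,s$, let $H_t$ be the bipartite graph on $V_r/{\sim_r}\cup V_s/{\sim_s}$ where $Q_rQ_s\in E(H_t)$ iff $G$ has an edge between $Q_r$ and $Q_s$ (then all edges between them are present). For $p\in\{r,s\}$, $\pi_p: V_p/{\sim_p}\to V_t/{\sim_t}$ maps a class to the unique class of $\sim_t$ containing it. A partial $b$-coloring of $G_t$ is a pair $(\mathcal{C},B)$ with $\mathcal{C}=(C_1,\ldots,C_k)$ a proper coloring of $G_t$ (an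 ordered partition of $V_t$ into independent sets, possibly empty) and $B\subseteq V_t$ with $|C_i\cap B|\le1$ for all $i$. For $B\subseteq V_t$ and an independent set $C$ of $G_t$ with $|C\cap B|\le1$, the $t$-type of $C$ w.r.t. $B$ is $(f,\beta)$ with $\beta=1$ iff $C\cap B\ne\emptyset$ (else $0$), and $f:V_t/{\sim_t}\to\{\mathrm{none},\mathrm{contains},\mathrm{demand}\}$: $f(Q)=\mathrm{contains}$ if $Q\cap C\ne\emptyset$; $f(Q)=\mathrm{demand}$ if $Q\cap C=\emptyset$ and some $v\in B\cap Q$ has $N_{G_t}(v)\cap C=\emptyset$; $f(Q)=\mathrm{none}$ otherwise. $\mathcal{T}_t$ is the set of all pairs $(f,\beta)$. $C$ is invalid w.r.t. $B$ if some $Q\in V_t/{\sim_t}$ has $Q\cap C\ne\emptyset$ and contains some $v\in B$ with $N_{G_t}[v]\cap C=\emptyset$; otherwise valid. The type/validity of a colour class $C_i$ of $(\mathcal{C},B)$ is that of $C_i$ w.r.t. $B$. Compatibility: $\rho=(f_r,\beta_r)\in\mathcal{T}_r$ and $\sigma=(f_s,\beta_s)\in\mathcal{T}_s$ are compatible if (1) $\beta_r+\beta_s\le1$; (2) no $Q_rQ_s\in E(H_t)$ has $f_r(Q_r)=f_s(Q_s)=\mathrm{contains}$; (3) for every $Q\in V_t/{\sim_t}$ such that some $p\in\{r,s\}$ and $Q_p\in\pi_p^{ -1}(Q)$ have $f_p(Q_p)=\mathrm{contains}$: each $Q_r\in\pi_r^{ -1}(Q)$ with $f_r(Q_r)=\mathrm{demand}$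 has an $H_t$-neighbor $Q_s$ with $f_s(Q_s)=\mathrm{contains}$, and each $Q_s\in\pi_s^{ -1}(Q)$ with $f_s(Q_s)=\mathrm{demand}$ has an $H_t$-neighbor $Q_r$ with $f_r(Q_r)=\mathrm{contains}$. -}

module Defs where

open import Data.Nat using (ℕ; _+_; _≤_)
open import Data.Fin using (Fin)
open import Data.Fin.Properties using (_≟_)
open import Data.Bool using (Bool; true; false; _∧_)
open import Data.List using (List; []; _∷_; _++_)
open import Data.Bool.ListAction using (any)
open import Data.List.Membership.Propositional using (_∈_)
open import Data.List.Relation.Unary.Unique.Propositional using (Unique)
open import Data.Product using (Σ; ∃; ∃₂; _×_; _,_)
open import Data.Sum using (_⊎_)
open import Relation.Nullary using (¬_; does)
open import Relation.Binary.PropositionalEquality using (_≡_; _≢_)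

record Graph (n : ℕ) : Set where
  field
    adj    : Fin n → Fin n → Bool
    sym    : ∀ u v → adj u v ≡ adj v u
    irrefl : ∀ v → adj v v ≡ false
open Graph public

VSet : ℕ → Set
VSet n = Fin n → Bool

_∩_ : ∀ {n} → VSet n → VSet n → VSet n
(X ∩ Y) v = X v ∧ Y v

-- Rooted trees of maximum degree ≤ 3 whose leaves are labelled by
-- vertices (the label of a leaf ℓ is δ⁻¹(ℓ)).
-- A non-root node has a parent, hence at most 2 children;
-- the root may have up to 3 children.

data SubTree (n : ℕ) : Set where
  leaf  : Fin n → SubTree n
  node1 : SubTree n → SubTree n
  node2 : SubTree n → SubTree n → SubTree n

data RTree (n : ℕ) : Set where
  rt    : SubTree n → RTree n
  root3 : SubTree n → SubTree n → SubTree n → RTree n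

leaves : ∀ {n} → SubTree n → List (Fin n)
leaves (leaf v)    = v ∷ []
leaves (node1 t)   = leaves t
leaves (node2 t u) = leaves t ++ leaves u

rleaves : ∀ {n} → RTree n → List (Fin n)
rleaves (rt t)        = leaves t
rleaves (root3 a b c) = leaves a ++ leaves b ++ leaves c

-- t ≼ u : t is (the subtree rooted at) a node of u
data _≼_ {n : ℕ} : SubTree n → SubTree n → Set where
  here   : ∀ {t} → t ≼ t
  in1    : ∀ {t u} → t ≼ u → t ≼ node1 u
  in2ˡ   : ∀ {t u w} → t ≼ u → t ≼ node2 u w
  in2ʳ   : ∀ {t u w} → t ≼ w → t ≼ node2 u w

data _≼ᴿ_ {n : ℕ} : SubTree n → RTree n → Set where
  inRt : ∀ {t u} → t ≼ u → t ≼ᴿ rt u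
  in3a : ∀ {t a b c} → t ≼ a → t ≼ᴿ root3 a b c
  in3b : ∀ {t a b c} → t ≼ b → t ≼ᴿ root3 a b c
  in3c : ∀ {t a b c} → t ≼ c → t ≼ᴿ root3 a b c

-- δ is a bijection V(G) → leaves: every vertex labels exactly one leaf
record RootedBranchDecomposition (n : ℕ) : Set where
  field
    tree   : RTree n
    covers : ∀ v → v ∈ rleaves tree
    unique : Unique (rleaves tree)
open RootedBranchDecomposition public

V : ∀ {n} → SubTree n → VSet n
V t v = any (λ u → does (u ≟ v)) (leaves t)

module _ {n : ℕ} (G : Graph n) where

  Equiv : SubTree n → Fin n → Fin n → Set
  Equiv t u v = ∀ w → V t w ≡ false → adj G u w ≡ adj G v w

  data Label : Set where
    none contains demand : Label

  Contains : SubTree n → VSet n → Fin n → Set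
  Contains t C v = ∃ λ u → C u ≡ true × V t u ≡ true × Equiv t u v

  NoNbrIn : SubTree n → VSet n → Fin n → Set
  NoNbrIn t C u = ∀ w → V t w ≡ true → adj G u w ≡ true → C w ≡ false

  DemandWitness : SubTree n → VSet n → VSet n → Fin n → Set
  DemandWitness t C B v =
    ∃ λ u → B u ≡ true × V t u ≡ true × Equiv t u v × NoNbrIn t C u

  data LabelOf (t : SubTree n) (C B : VSet n) (v : Fin n) : Label → Set where
    isContains : Contains t C v → LabelOf t C B v contains
    isDemand   : ¬ Contains t C v → DemandWitness t C B v → LabelOf t C B v demand
    isNone     : ¬ Contains t C v → ¬ DemandWitness t C B v → LabelOf t C B v none

  -- a t-type (f, β); f is given on representatives v ∈ V_t
  record TType : Set where
    constructor ⟨_,_⟩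
    field
      f : Fin n → Label
      β : Bool
  open TType public

  HasType : SubTree n → VSet n → VSet n → TType → Set
  HasType t C B τ =
    (∀ v → V t v ≡ true → LabelOf t C B v (f τ v)) ×
    ((β τ ≡ true → ∃ λ u → C u ≡ true × B u ≡ true) ×
     ((∃ λ u → C u ≡ true × B u ≡ true) → β τ ≡ true))

  Invalid : SubTree n → VSet n → VSet n → Set
  Invalid t C B = ∃₂ λ u v →
    C u ≡ true × V t u ≡ true × B v ≡ true × V t v ≡ true × Equiv t u v ×
    (∀ w → V t w ≡ true → (w ≡ v ⊎ adj G v w ≡ true) → C w ≡ false)

  Valid : SubTree n → VSet n → VSet n → Set
  Valid t C B = ¬ Invalid t C B

  HEdge : SubTree n → SubTree n → Fin n → Fin n → Set
  HEdge r s u w = ∃₂ λ u' w' →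
    V r u' ≡ true × V s w' ≡ true × Equiv r u' u × Equiv s w' w × adj G u' w' ≡ true

  bit : Bool → ℕ
  bit false = 0
  bit true  = 1

  Compatible : SubTree n → SubTree n → SubTree n → TType → TType → Set
  Compatible t r s ρ σ =
    (bit (β ρ) + bit (β σ) ≤ 1) ×
    (∀ u w → V r u ≡ true → V s w ≡ true → HEdge r s u w →
       ¬ (f ρ u ≡ contains × f σ w ≡ contains)) ×
    (∀ x → V t x ≡ true →
       ((∃ λ y → V r y ≡ true × Equiv t y x × f ρ y ≡ contains) ⊎
        (∃ λ y → V s y ≡ true × Equiv t y x × f σ y ≡ contains)) →
       (∀ u → V r u ≡ true → Equiv t u x → f ρ u ≡ demand →
          ∃ λ w → V s w ≡ true × HEdge r s u w × f σ w ≡ contains) ×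
       (∀ w → V s w ≡ true → Equiv t w x → f σ w ≡ demand →
          ∃ λ u → V r u ≡ true × HEdge r s u w × f ρ u ≡ contains))

  -- partial b-colouring (𝒞, B) of G_t, 𝒞 = (C_0, …, C_{k-1}) given by
  -- the colour col v of each v ∈ V_t (values outside V_t are irrelevant)
  record PartialBColoring (t : SubTree n) : Set where
    field
      k      : ℕ
      col    : Fin n → Fin k
      B      : VSet n
      proper : ∀ u v → V t u ≡ true → V t v ≡ true → adj G u v ≡ true → col u ≢ col v
      B⊆Vt   : ∀ v → B v ≡ true → V t v ≡ true
      atMostOneB : ∀ u v → V t u ≡ true → V t v ≡ true → B u ≡ true → B v ≡ true →
                   col u ≡ col v → u ≡ v

    colourClass : Fin k → VSet n
    colourClass i v = V t v ∧ does (col v ≟ i)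
  open PartialBColoring public

module Submission where

-- We take ρ and σ to be the r-type of C ∩ V_r and the s-type of C ∩ V_s
-- (every set has a type, since all the predicates involved are decidable
-- over the finite vertex set).  Everything else only uses three facts
-- about C: it is independent, it meets B at most once, and it is valid
-- at t; plus the fact that V_r and V_s are disjoint, which follows from
-- δ being a bijection.
--
-- The central observation is that a B-vertex v of
-- a sub-node p whose closed neighbourhood in G_p misses C, but whose
-- closed neighbourhood in G_t meets C, has a neighbour w ∈ C outside
-- V_p; since v and any u ∼_p v see w alike, C cannot meet the class of
-- v (independence).  This gives validity of the restrictions and
-- resolves every demand of one child by a `contains' of the other,
-- which is condition (3) of compatibility; conditions (1) and (2)
-- follow from |C ∩ B| ≤ 1 and independence.  The theorem combines these.

open import Defs renaming (sym to adj-sym)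
open import Data.Nat using (ℕ; _+_; _≤_; z≤n; s≤s)
open import Data.Fin using (Fin)
open import Data.Fin.Properties using (any?; all?) renaming (_≟_ to _≟F_)
open import Data.Bool using (Bool; true; false; _∧_; _∨_)
open import Data.Bool.Properties
  using (∨-assoc; ∨-zeroʳ; ∧-conicalˡ; ∧-conicalʳ; ¬-not) renaming (_≟_ to _≟B_)
open import Data.List using (List; []; _∷_; _++_)
open import Data.Bool.ListAction using (any)
open import Data.List.Membership.Propositional using (_∈_)
open import Data.List.Relation.Unary.Any using (here; there)
open import Data.List.Relation.Unary.All using (lookup)
open import Data.List.Relation.Unary.All.Properties using (++⁻ˡ; ++⁻ʳ)
open import Data.List.Relation.Unary.AllPairs using ([]; _∷_)
open import Data.List.Relation.Unary.Unique.Propositional using (Unique)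
open import Data.Product using (Σ; ∃; ∃₂; _×_; _,_; proj₁; proj₂)
open import Data.Sum using (_⊎_; inj₁; inj₂)
open import Data.Empty using (⊥; ⊥-elim)
open import Relation.Nullary using (¬_; Dec; yes; no; does)
open import Relation.Nullary.Decidable.Core using (_×-dec_; _→-dec_; _⊎-dec_)
open import Relation.Binary.PropositionalEquality
  using (_≡_; refl; sym; trans; cong; subst)

true≢false : ∀ {b} → b ≡ true → b ≡ false → ⊥
true≢false refl ()

∧-intro : ∀ {a b} → a ≡ true → b ≡ true → a ∧ b ≡ true
∧-intro refl refl = refl

_⊆ᵛ_ : ∀ {n} → VSet n → VSet n → Set
X ⊆ᵛ Y = ∀ v → X v ≡ true → Y v ≡ true

any≟→∈ : ∀ {n} (xs : List (Fin n)) v → any (λ u → does (u ≟F v)) xs ≡ true → v ∈ xs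
any≟→∈ []       v ()
any≟→∈ (x ∷ xs) v e with x ≟F v
... | yes refl = here refl
... | no _     = there (any≟→∈ xs v e)

any-++ : ∀ {A : Set} (p : A → Bool) (xs ys : List A) →
         any p (xs ++ ys) ≡ (any p xs ∨ any p ys)
any-++ p []       ys = refl
any-++ p (x ∷ xs) ys rewrite any-++ p xs ys = sym (∨-assoc (p x) _ _)

V-node2 : ∀ {n} (r s : SubTree n) v → V (node2 r s) v ≡ (V r v ∨ V s v)
V-node2 r s v = any-++ _ (leaves r) (leaves s)

V-left : ∀ {n} (r s : SubTree n) → V r ⊆ᵛ V (node2 r s)
V-left r s v e = trans (V-node2 r s v) (cong (_∨ V s v) e)

V-right : ∀ {n} (r s : SubTree n) → V s ⊆ᵛ V (node2 r s)
V-right r s v e = trans (V-node2 r s v) (trans (cong (V r v ∨_) e) (∨-zeroʳ (V r v)))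

Covers : ∀ {n} → SubTree n → SubTree n → SubTree n → Set
Covers t p q = ∀ v → V t v ≡ true → V p v ≡ false → V q v ≡ true

covers-right : ∀ {n} (r s : SubTree n) → Covers (node2 r s) r s
covers-right r s v e ∉r = trans (cong (_∨ V s v) (sym ∉r)) (trans (sym (V-node2 r s v)) e)

covers-left : ∀ {n} (r s : SubTree n) → Covers (node2 r s) s r
covers-left r s v e ∉s with V r v in ∈r
... | true  = refl
... | false = ⊥-elim (true≢false (covers-right r s v e ∈r) ∉s)

Unique-++ˡ : ∀ {A : Set} (xs : List A) {ys} → Unique (xs ++ ys) → Unique xs
Unique-++ˡ []       _          = []
Unique-++ˡ (x ∷ xs) (x∉ ∷ xs!) = ++⁻ˡ xs x∉ ∷ Unique-++ˡ xs xs!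

Unique-++ʳ : ∀ {A : Set} (xs : List A) {ys} → Unique (xs ++ ys) → Unique ys
Unique-++ʳ []       ys!       = ys!
Unique-++ʳ (x ∷ xs) (_ ∷ xs!) = Unique-++ʳ xs xs!

Unique-++-disjoint : ∀ {A : Set} (xs : List A) {ys} → Unique (xs ++ ys) →
                     ∀ {v} → v ∈ xs → v ∈ ys → ⊥
Unique-++-disjoint (x ∷ xs) (x∉ ∷ _)   (here refl) v∈ys = lookup (++⁻ʳ xs x∉) v∈ys refl
Unique-++-disjoint (x ∷ xs) (_ ∷ xs!) (there v∈xs) v∈ys = Unique-++-disjoint xs xs! v∈xs v∈ys

unique-sub : ∀ {n} {t u : SubTree n} → t ≼ u → Unique (leaves u) → Unique (leaves t)
unique-sub here                   u! = u!
unique-sub (in1 t≼)               u! = unique-sub t≼ u!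
unique-sub (in2ˡ {u = a} t≼)      u! = unique-sub t≼ (Unique-++ˡ (leaves a) u!)
unique-sub (in2ʳ {u = a} t≼)      u! = unique-sub t≼ (Unique-++ʳ (leaves a) u!)

unique-subᴿ : ∀ {n} {t : SubTree n} {T : RTree n} → t ≼ᴿ T → Unique (rleaves T) → Unique (leaves t)
unique-subᴿ (inRt t≼)                  T! = unique-sub t≼ T!
unique-subᴿ (in3a {a = a} t≼)          T! = unique-sub t≼ (Unique-++ˡ (leaves a) T!)
unique-subᴿ (in3b {a = a} {b} t≼)      T! = unique-sub t≼ (Unique-++ˡ (leaves b) (Unique-++ʳ (leaves a) T!))
unique-subᴿ (in3c {a = a} {b} t≼)      T! = unique-sub t≼ (Unique-++ʳ (leaves b) (Unique-++ʳ (leaves a) T!))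

-- The two children of a node of a branch decomposition have disjoint
-- vertex sets, because δ is injective.
children-disjoint : ∀ {n} (D : RootedBranchDecomposition n) {r s : SubTree n} →
  node2 r s ≼ᴿ tree D → ∀ v → V r v ≡ true → V s v ≡ true → ⊥
children-disjoint D {r} {s} pos v ∈r ∈s =
  Unique-++-disjoint (leaves r) (unique-subᴿ pos (unique D))
    (any≟→∈ (leaves r) v ∈r) (any≟→∈ (leaves s) v ∈s)

module _ {n : ℕ} (G : Graph n) where

  Independent : VSet n → Set
  Independent C = ∀ u w → C u ≡ true → C w ≡ true → adj G u w ≡ true → ⊥

  AtMostOneIn : VSet n → VSet n → Set
  AtMostOneIn B C = ∀ u w → C u ≡ true → C w ≡ true → B u ≡ true → B w ≡ true → u ≡ w

  Equiv-refl : ∀ t u → Equiv G t u u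
  Equiv-refl t u w _ = refl

  Equiv-sym : ∀ t {u v} → Equiv G t u v → Equiv G t v u
  Equiv-sym t u∼v w ∉t = sym (u∼v w ∉t)

  Equiv-trans : ∀ t {u v x} → Equiv G t u v → Equiv G t v x → Equiv G t u x
  Equiv-trans t u∼v v∼x w ∉t = trans (u∼v w ∉t) (v∼x w ∉t)

  Equiv-lift : ∀ p t → V p ⊆ᵛ V t → ∀ {u v} → Equiv G p u v → Equiv G t u v
  Equiv-lift p t p⊆t u∼v w ∉t = u∼v w (¬-not (λ ∈p → true≢false (p⊆t w ∈p) ∉t))

  HEdge-swap : ∀ {p q u w} → HEdge G q p w u → HEdge G p q u w
  HEdge-swap (w' , u' , ∈q , ∈p , w'∼w , u'∼u , a) = u' , w' , ∈p , ∈q , u'∼u , w'∼w , trans (adj-sym G u' w') a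

  -- Every set has a t-type with respect to every B: all predicates in the
  -- definition of a type quantify over the finite set V(G), so they are
  -- decidable.
  Equiv? : ∀ t u v → Dec (Equiv G t u v)
  Equiv? t u v = all? (λ w → (V t w ≟B false) →-dec (adj G u w ≟B adj G v w))

  Contains? : ∀ t C v → Dec (Contains G t C v)
  Contains? t C v = any? (λ u → (C u ≟B true) ×-dec ((V t u ≟B true) ×-dec Equiv? t u v))

  NoNbrIn? : ∀ t C u → Dec (NoNbrIn G t C u)
  NoNbrIn? t C u = all? (λ w → (V t w ≟B true) →-dec ((adj G u w ≟B true) →-dec (C w ≟B false)))

  DemandWitness? : ∀ t C B v → Dec (DemandWitness G t C B v)
  DemandWitness? t C B v =
    any? (λ u → (B u ≟B true) ×-dec ((V t u ≟B true) ×-dec (Equiv? t u v ×-dec NoNbrIn? t C u)))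

  labelOf : ∀ t C B v → Σ (Label G) (LabelOf G t C B v)
  labelOf t C B v with Contains? t C v
  ... | yes c = contains , isContains c
  ... | no ¬c with DemandWitness? t C B v
  ...   | yes d = demand , isDemand ¬c d
  ...   | no ¬d = none , isNone ¬c ¬d

  labelling : ∀ t C B → Fin n → Label G
  labelling t C B v = proj₁ (labelOf t C B v)

  typeOf : ∀ t C B → Σ (TType G) (HasType G t C B)
  typeOf t C B with any? (λ u → (C u ≟B true) ×-dec (B u ≟B true))
  ... | yes meets = ⟨ labelling t C B , true ⟩ ,
                    (λ v _ → proj₂ (labelOf t C B v)) , (λ _ → meets) , (λ _ → refl)
  ... | no misses = ⟨ labelling t C B , false ⟩ ,
                    (λ v _ → proj₂ (labelOf t C B v)) , (λ ()) , (λ m → ⊥-elim (misses m))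

  label-contains : ∀ {t C B v} → LabelOf G t C B v contains → Contains G t C v
  label-contains (isContains c) = c

  label-demand : ∀ {t C B v} → LabelOf G t C B v demand →
                 ¬ Contains G t C v × DemandWitness G t C B v
  label-demand (isDemand ¬c d) = ¬c , d

  contains-label : ∀ {t C B v l} → LabelOf G t C B v l → Contains G t C v → l ≡ contains
  contains-label (isContains _) _ = refl
  contains-label (isDemand ¬c _) c = ⊥-elim (¬c c)
  contains-label (isNone ¬c _) c = ⊥-elim (¬c c)

  labelAt : ∀ {p C B ρ} → HasType G p (C ∩ V p) B ρ → ∀ {v} → V p v ≡ true →
            LabelOf G p (C ∩ V p) B v (f ρ v)
  labelAt hasρ {v} ∈p = proj₁ hasρ v ∈p

  contains-meets : ∀ p t {C B ρ} → V p ⊆ᵛ V t → HasType G p (C ∩ V p) B ρ →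
    ∀ {y x} → V p y ≡ true → Equiv G t y x → f ρ y ≡ contains →
    ∃ λ z → C z ≡ true × V t z ≡ true × Equiv G t z x
  contains-meets p t p⊆t hasρ ∈p y∼x fy≡c
    with label-contains (subst (LabelOf G p _ _ _) fy≡c (labelAt hasρ ∈p))
  ... | z , z∈C∩p , z∈p , z∼y =
    z , ∧-conicalˡ _ _ z∈C∩p , p⊆t z z∈p , Equiv-trans t (Equiv-lift p t p⊆t z∼y) y∼x

  module Restriction (t : SubTree n) (C B : VSet n)
                     (independent : Independent C) (valid : Valid G t C B) where

    ClosedNbrMeets : Fin n → Set
    ClosedNbrMeets v = ∃ λ w → V t w ≡ true × (w ≡ v ⊎ adj G v w ≡ true) × C w ≡ true

    closedNbrMeets? : ∀ v → Dec (ClosedNbrMeets v)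
    closedNbrMeets? v =
      any? (λ w → (V t w ≟B true) ×-dec (((w ≟F v) ⊎-dec (adj G v w ≟B true)) ×-dec (C w ≟B true)))

    missed-class : ∀ {u v} → ¬ ClosedNbrMeets v → C u ≡ true → V t u ≡ true →
                   B v ≡ true → V t v ≡ true → Equiv G t u v → ⊥
    missed-class ¬meets u∈C u∈t v∈B v∈t u∼v =
      valid (_ , _ , u∈C , u∈t , v∈B , v∈t , u∼v ,
             λ w w∈t near → ¬-not (λ w∈C → ¬meets (w , w∈t , near , w∈C)))

    -- If u ∈ C and v ∈ B lie in one ∼_p-class with N_{G_p}[v] ∩ C = ∅,
    -- a neighbour w ∈ C of v outside V_p would also be adjacent to u.
    restriction-valid : ∀ p → V p ⊆ᵛ V t → Valid G p (C ∩ V p) (B ∩ V p)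
    restriction-valid p p⊆t (u , v , u∈C∩p , u∈p , v∈B∩p , v∈p , u∼v , noNbr)
      with closedNbrMeets? v
    ... | no ¬meets =
      missed-class ¬meets (∧-conicalˡ _ _ u∈C∩p) (p⊆t u u∈p) (∧-conicalˡ _ _ v∈B∩p)
                   (p⊆t v v∈p) (Equiv-lift p t p⊆t u∼v)
    ... | yes (w , _ , near , w∈C) with V p w in w∈?p
    ...   | true = true≢false (∧-intro w∈C w∈?p) (noNbr w w∈?p near)
    ...   | false with near
    ...     | inj₁ refl = true≢false v∈p w∈?p
    ...     | inj₂ vw   = independent u w (∧-conicalˡ _ _ u∈C∩p) w∈C (trans (u∼v w w∈?p) vw)

    demand-answered : ∀ p q → V p ⊆ᵛ V t → Covers t p q →
      ∀ {u z} → C z ≡ true → V t z ≡ true → Equiv G t z u →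
      ¬ Contains G p (C ∩ V p) u → DemandWitness G p (C ∩ V p) (B ∩ V p) u →
      ∃₂ λ v w → V p v ≡ true × Equiv G p v u × V q w ≡ true × adj G v w ≡ true × C w ≡ true
    demand-answered p q p⊆t cover z∈C z∈t z∼u ¬c (v , v∈B∩p , v∈p , v∼u , noNbr)
      with closedNbrMeets? v
    ... | no ¬meets =
      ⊥-elim (missed-class ¬meets z∈C z∈t (∧-conicalˡ _ _ v∈B∩p) (p⊆t v v∈p)
                (Equiv-trans t z∼u (Equiv-sym t (Equiv-lift p t p⊆t v∼u))))
    ... | yes (w , w∈t , inj₁ refl , w∈C) = ⊥-elim (¬c (w , ∧-intro w∈C v∈p , v∈p , v∼u))
    ... | yes (w , w∈t , inj₂ vw , w∈C) with V p w in w∈?p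
    ...   | true  = ⊥-elim (true≢false (∧-intro w∈C w∈?p) (noNbr w w∈?p vw))
    ...   | false = v , w , v∈p , v∼u , cover w w∈t w∈?p , vw , w∈C

    demand-met : ∀ p q → V p ⊆ᵛ V t → Covers t p q → ∀ {ρ σ} →
      HasType G p (C ∩ V p) (B ∩ V p) ρ → HasType G q (C ∩ V q) (B ∩ V q) σ →
      ∀ {u z} → C z ≡ true → V t z ≡ true → Equiv G t z u →
      V p u ≡ true → f ρ u ≡ demand →
      ∃ λ w → V q w ≡ true × HEdge G p q u w × f σ w ≡ contains
    demand-met p q p⊆t cover hasρ hasσ z∈C z∈t z∼u u∈p fu≡d
      with label-demand (subst (LabelOf G p _ _ _) fu≡d (labelAt hasρ u∈p))
    ... | ¬c , d with demand-answered p q p⊆t cover z∈C z∈t z∼u ¬c d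
    ... | v , w , v∈p , v∼u , w∈q , vw , w∈C =
      w , w∈q , (v , w , v∈p , w∈q , v∼u , Equiv-refl q w , vw) ,
      contains-label (labelAt hasσ w∈q) (w , ∧-intro w∈C w∈q , w∈q , Equiv-refl q w)

  bit-sum≤1 : ∀ a b → (a ≡ true → b ≡ true → ⊥) → bit G a + bit G b ≤ 1
  bit-sum≤1 false false _ = z≤n
  bit-sum≤1 false true  _ = s≤s z≤n
  bit-sum≤1 true  false _ = s≤s z≤n
  bit-sum≤1 true  true  both = ⊥-elim (both refl refl)

  module Children (r s : SubTree n) (C B : VSet n)
                  (disjoint : ∀ v → V r v ≡ true → V s v ≡ true → ⊥)
                  (independent : Independent C) (oneB : AtMostOneIn B C)
                  (valid : Valid G (node2 r s) C B) where

    t : SubTree n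
    t = node2 r s

    open Restriction t C B independent valid public

    restrictions-compatible : ∀ {ρ σ} →
      HasType G r (C ∩ V r) (B ∩ V r) ρ → HasType G s (C ∩ V s) (B ∩ V s) σ →
      Compatible G t r s ρ σ
    restrictions-compatible {ρ} {σ} hasρ hasσ =
      bit-sum≤1 (β ρ) (β σ) at-most-one-marked , no-contains-edge , demands-met
      where
        -- Both restrictions cannot meet B: C ∩ B has at most one vertex.
        at-most-one-marked : β ρ ≡ true → β σ ≡ true → ⊥
        at-most-one-marked βρ βσ with proj₁ (proj₂ hasρ) βρ | proj₁ (proj₂ hasσ) βσ
        ... | u , u∈C∩r , u∈B∩r | w , w∈C∩s , w∈B∩s =
          disjoint w (subst (λ x → V r x ≡ true) u≡w (∧-conicalʳ _ _ u∈C∩r)) (∧-conicalʳ _ _ w∈C∩s)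
          where
            u≡w : u ≡ w
            u≡w = oneB u w (∧-conicalˡ _ _ u∈C∩r) (∧-conicalˡ _ _ w∈C∩s)
                           (∧-conicalˡ _ _ u∈B∩r) (∧-conicalˡ _ _ w∈B∩s)

        no-contains-edge : ∀ u w → V r u ≡ true → V s w ≡ true → HEdge G r s u w →
                           ¬ (f ρ u ≡ contains × f σ w ≡ contains)
        no-contains-edge u w u∈r w∈s (u' , w' , _ , w'∈s , u'∼u , w'∼w , u'w') (fu≡c , fw≡c)
          with label-contains (subst (LabelOf G r _ _ _) fu≡c (labelAt hasρ u∈r))
             | label-contains (subst (LabelOf G s _ _ _) fw≡c (labelAt hasσ w∈s))
        ... | x , x∈C∩r , x∈r , x∼u | y , y∈C∩s , y∈s , y∼w =
          independent y x (∧-conicalˡ _ _ y∈C∩s) (∧-conicalˡ _ _ x∈C∩r) yx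
          where
            xw' : adj G x w' ≡ true
            xw' = trans (Equiv-trans r x∼u (Equiv-sym r u'∼u) w'
                           (¬-not (λ w'∈r → disjoint w' w'∈r w'∈s))) u'w'
            yx : adj G y x ≡ true
            yx = trans (Equiv-trans s y∼w (Equiv-sym s w'∼w) x
                          (¬-not (disjoint x x∈r))) (trans (adj-sym G w' x) xw')

        class-meets-C : ∀ {x} →
          ((∃ λ y → V r y ≡ true × Equiv G t y x × f ρ y ≡ contains) ⊎
           (∃ λ y → V s y ≡ true × Equiv G t y x × f σ y ≡ contains)) →
          ∃ λ z → C z ≡ true × V t z ≡ true × Equiv G t z x
        class-meets-C (inj₁ (y , y∈r , y∼x , fy≡c)) = contains-meets r t (V-left r s) hasρ y∈r y∼x fy≡c
        class-meets-C (inj₂ (y , y∈s , y∼x , fy≡c)) = contains-meets s t (V-right r s) hasσ y∈s y∼x fy≡c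

        demands-met : ∀ x → V t x ≡ true →
          ((∃ λ y → V r y ≡ true × Equiv G t y x × f ρ y ≡ contains) ⊎
           (∃ λ y → V s y ≡ true × Equiv G t y x × f σ y ≡ contains)) →
          (∀ u → V r u ≡ true → Equiv G t u x → f ρ u ≡ demand →
             ∃ λ w → V s w ≡ true × HEdge G r s u w × f σ w ≡ contains) ×
          (∀ w → V s w ≡ true → Equiv G t w x → f σ w ≡ demand →
             ∃ λ u → V r u ≡ true × HEdge G r s u w × f ρ u ≡ contains)
        demands-met x _ meets with class-meets-C meets
        ... | z , z∈C , z∈t , z∼x = from-r , from-s
          where
            from-r : ∀ u → V r u ≡ true → Equiv G t u x → f ρ u ≡ demand →
                     ∃ λ w → V s w ≡ true × HEdge G r s u w × f σ w ≡ contains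
            from-r u u∈r u∼x =
              demand-met r s (V-left r s) (covers-right r s) hasρ hasσ z∈C z∈t
                (Equiv-trans t z∼x (Equiv-sym t u∼x)) u∈r
            from-s : ∀ w → V s w ≡ true → Equiv G t w x → f σ w ≡ demand →
                     ∃ λ u → V r u ≡ true × HEdge G r s u w × f ρ u ≡ contains
            from-s w w∈s w∼x fw≡d
              with demand-met s r (V-right r s) (covers-left r s) hasσ hasρ z∈C z∈t
                     (Equiv-trans t z∼x (Equiv-sym t w∼x)) w∈s fw≡d
            ... | u , u∈r , e , fu≡c = u , u∈r , HEdge-swap {p = r} {q = s} e , fu≡c

  module _ {t : SubTree n} (P : PartialBColoring G t) (i : Fin (k P)) where

    colour-matches : ∀ {v} → does (col P v ≟F i) ≡ true → col P v ≡ i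
    colour-matches {v} e with col P v ≟F i
    ... | yes same = same
    ... | no _     = ⊥-elim (true≢false e refl)

    colourClass-member : ∀ {v} → colourClass P i v ≡ true → V t v ≡ true × col P v ≡ i
    colourClass-member e = ∧-conicalˡ _ _ e , colour-matches (∧-conicalʳ _ _ e)

    same-colour : ∀ {u w} → colourClass P i u ≡ true → colourClass P i w ≡ true → col P u ≡ col P w
    same-colour u∈C w∈C = trans (proj₂ (colourClass-member u∈C)) (sym (proj₂ (colourClass-member w∈C)))

    colourClass-independent : Independent (colourClass P i)
    colourClass-independent u w u∈C w∈C uw =
      proper P u w (proj₁ (colourClass-member u∈C)) (proj₁ (colourClass-member w∈C)) uw
        (same-colour u∈C w∈C)

    colourClass-oneB : AtMostOneIn (B P) (colourClass P i)
    colourClass-oneB u w u∈C w∈C u∈B w∈B =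
      atMostOneB P u w (proj₁ (colourClass-member u∈C)) (proj₁ (colourClass-member w∈C)) u∈B w∈B
        (same-colour u∈C w∈C)

mainTheorem7 : ∀ {n} (G : Graph n) (D : RootedBranchDecomposition n)
    (r s : SubTree n) → node2 r s ≼ᴿ tree D →
    (τ : TType G) (P : PartialBColoring G (node2 r s)) (i : Fin (k P)) →
    Valid G (node2 r s) (colourClass P i) (B P) →
    HasType G (node2 r s) (colourClass P i) (B P) τ →
    ∃₂ λ (ρ σ : TType G) →
      Compatible G (node2 r s) r s ρ σ ×
      Valid G r (colourClass P i ∩ V r) (B P ∩ V r) ×
      HasType G r (colourClass P i ∩ V r) (B P ∩ V r) ρ ×
      Valid G s (colourClass P i ∩ V s) (B P ∩ V s) ×
      HasType G s (colourClass P i ∩ V s) (B P ∩ V s) σ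
mainTheorem7 G D r s pos _ P i valid _
  with typeOf G r (colourClass P i ∩ V r) (B P ∩ V r)
     | typeOf G s (colourClass P i ∩ V s) (B P ∩ V s)
... | ρ , hasρ | σ , hasσ =
  ρ , σ , restrictions-compatible hasρ hasσ ,
  restriction-valid r (V-left r s) , hasρ , restriction-valid s (V-right r s) , hasσ
  where
    open Children G r s (colourClass P i) (B P) (children-disjoint D pos)
                  (colourClass-independent G P i) (colourClass-oneB G P i) valid
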